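{- If $\mathbb{H}=(\mathbb{L},\mathbb{D},e,h)$ is a heterogeneous semi De Morgan algebra (resp. heterogeneous demi pseudocomplemented lattice), then $\mathbb{H}_+$ is a semi De Morgan algebra (resp. demi pseudocomplemented lattice). Moreover, the kernel of $\mathbb{H}_+$ is isomorphic to $\mathbb{D}$ (as De Morgan algebras, resp. Boolean algebras).
   Context: A heterogeneous semi De Morgan algebra (HSMA) is a tuple $(\mathbb{L},\mathbb{D},e,h)$ with: $\mathbb{L}=(L,\wedge,\vee,\top,\bot)$ a bounded distributive lattice; $\mathbb{D}=(D,\cap,\cup,{}^*,1,0)$ a De Morgan algebra (bounded distributive lattice with $0^*=1$, $1^*=0$, $(a\cup b)^*=a^*\cap b^*$, $(a\cap b)^*=a^*\cup b^*$, $a^{**}=a$); $e:\mathbb{D}\to\mathbb{L}$ an order embedding with $e(\alpha_1)\wedge e(\alpha_2)=e(\alpha_1\cap\alpha_2)$, $e(1)=\top$, $e(0)=\bot$; $h:\mathbb{L}\to\mathbb{D}$ a surjective lattice homomorphism; $h(e(\alpha))=\alpha$ for all $\alpha\in D$. A heterogeneous demi pseudocomplemented lattice (HDPL) is the same with $\mathbb{D}$ a Boolean algebra (a De Morgan algebra with $a\cap a^*=0$). For such $\mathbb{H}$, $\mathbb{H}_+=(\mathbb{L},{}')$ where $a'=e(h(a)^*)$ for $a\in L$. A semi De Morgan algebra (SMA) is an algebra $(L,\wedge,\vee,{}',\top,\bot)$ such that $(L,\wedge,\vee,\top,\bot)$ is a bounded distributive lattice and $\bot'=\top$, $\top'=\bot$,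 $(a\vee b)'=a'\wedge b'$, $(a\wedge b)''=a''\wedge b''$, $a'=a'''$; a demi pseudocomplemented lattice is an SMA with $a'\wedge a''=\bot$. The kernel of an SMA is $(K,\cap_k,\cup_k,{}^{*_k},1_k,0_k)$ where $K=\{a'':a\in L\}$, $h_k(a)=a''$, $e_k:K\to L$ the inclusion, $\alpha\cup_k\beta=h_k((e_k(\alpha)\vee e_k(\beta))'')$, $\alpha\cap_k\beta=h_k(e_k(\alpha)\wedge e_k(\beta))$, $1_k=h_k(\top)$, $0_k=h_k(\bot)$, $\alpha^{*_k}=h_k(e_k(\alpha)')$. -}

module Defs where

open import Level using (Level; _⊔_) renaming (suc to lsuc)
open import Data.Product using (Σ; ∃; _×_; _,_; proj₁)
open import Relation.Binary.PropositionalEquality using (_≡_; refl)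
open import Algebra.Core using (Op₁; Op₂)
open import Algebra.Lattice.Structures using (IsDistributiveLattice)
open import Function.Base using (_∘_)

record BDL (A : Set) : Set where
  field
    _∧_ _∨_ : Op₂ A
    ⊤ ⊥ : A
    isDistributiveLattice : IsDistributiveLattice _≡_ _∨_ _∧_
    ∧-⊤ : ∀ a → (a ∧ ⊤) ≡ a
    ∨-⊥ : ∀ a → (a ∨ ⊥) ≡ a

  _≤_ : A → A → Set
  a ≤ b = (a ∧ b) ≡ a

record DeMorgan (D : Set) : Set where
  field
    bdl : BDL D
  open BDL bdl public renaming (_∧_ to _∩_; _∨_ to _∪_; ⊤ to 1d; ⊥ to 0d)
  field
    _* : Op₁ D
    0*≡1 : (0d *) ≡ 1d
    1*≡0 : (1d *) ≡ 0d
    ∪-* : ∀ a b → ((a ∪ b) *) ≡ ((a *) ∩ (b *))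
    ∩-* : ∀ a b → ((a ∩ b) *) ≡ ((a *) ∪ (b *))
    ** : ∀ a → ((a *) *) ≡ a

record Boolean (D : Set) : Set where
  field
    deMorgan : DeMorgan D
  open DeMorgan deMorgan public
  field
    ∩-compl : ∀ a → (a ∩ (a *)) ≡ 0d

record HSMA (L D : Set) : Set where
  field
    𝕃 : BDL L
    𝔻 : DeMorgan D
    e : D → L
    h : L → D
  module L = BDL 𝕃
  module D = DeMorgan 𝔻
  field
    e-mono : ∀ α β → α D.≤ β → e α L.≤ e β
    e-refl : ∀ α β → e α L.≤ e β → α D.≤ β
    e-∩ : ∀ α₁ α₂ → (e α₁ L.∧ e α₂) ≡ e (α₁ D.∩ α₂)
    e-1 : e D.1d ≡ L.⊤
    e-0 : e D.0d ≡ L.⊥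
    h-∧ : ∀ a b → h (a L.∧ b) ≡ (h a D.∩ h b)
    h-∨ : ∀ a b → h (a L.∨ b) ≡ (h a D.∪ h b)
    h-surj : ∀ α → ∃ λ a → h a ≡ α
    h∘e : ∀ α → h (e α) ≡ α

record HDPL (L D : Set) : Set where
  field
    hsma : HSMA L D
  open HSMA hsma public
  field
    D-compl : ∀ α → (α D.∩ (α D.*)) ≡ D.0d

prime₊ : ∀ {L D} → HSMA L D → Op₁ L
prime₊ H a = e ((h a) D.*)
  where open HSMA H

record IsSMA {L : Set} (𝕃 : BDL L) (_′ : Op₁ L) : Set where
  open BDL 𝕃
  field
    ⊥′ : (⊥ ′) ≡ ⊤
    ⊤′ : (⊤ ′) ≡ ⊥
    ∨′ : ∀ a b → ((a ∨ b) ′) ≡ ((a ′) ∧ (b ′))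
    ∧′′ : ∀ a b → (((a ∧ b) ′) ′) ≡ (((a ′) ′) ∧ ((b ′) ′))
    ′′′ : ∀ a → (a ′) ≡ (((a ′) ′) ′)

record IsDemiPL {L : Set} (𝕃 : BDL L) (_′ : Op₁ L) : Set where
  open BDL 𝕃
  field
    isSMA : IsSMA 𝕃 _′
    ′-∧-′′ : ∀ a → ((a ′) ∧ ((a ′) ′)) ≡ ⊥

module Kernel {L : Set} (𝕃 : BDL L) (_′ : Op₁ L) where
  open BDL 𝕃

  K : Set
  K = Σ L λ x → ∃ λ a → x ≡ ((a ′) ′)

  _≈K_ : K → K → Set
  x ≈K y = proj₁ x ≡ proj₁ y

  hk : L → K
  hk a = ((a ′) ′) , a , refl

  ek : K → L
  ek = proj₁

  _∪k_ : Op₂ K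
  α ∪k β = hk (((ek α ∨ ek β) ′) ′)

  _∩k_ : Op₂ K
  α ∩k β = hk (ek α ∧ ek β)

  1k : K
  1k = hk ⊤

  0k : K
  0k = hk ⊥

  _*k : Op₁ K
  α *k = hk (ek α ′)

-- Isomorphism (of De Morgan / Boolean algebras: same signature) between
-- the kernel of (𝕃, ') and a De Morgan algebra 𝔻: a bijection preserving
-- ∩, ∪, *, 1, 0.
record KernelIso {L D : Set} (𝕃 : BDL L) (_′ : Op₁ L) (𝔻 : DeMorgan D) : Set where
  open Kernel 𝕃 _′
  module D = DeMorgan 𝔻
  field
    to : K → D
    from : D → K
    to-resp : ∀ x y → x ≈K y → to x ≡ to y
    to∘from : ∀ α → to (from α) ≡ α
    from∘to : ∀ x → from (to x) ≈K x
    to-∩ : ∀ x y → to (x ∩k y) ≡ (to x D.∩ to y)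
    to-∪ : ∀ x y → to (x ∪k y) ≡ (to x D.∪ to y)
    to-* : ∀ x → to (x *k) ≡ ((to x) D.*)
    to-1 : to 1k ≡ D.1d
    to-0 : to 0k ≡ D.0d

module Submission where

-- Because h ∘ e = id
-- and * is an involution, the whole structure is governed by two identities:
--     h (a′)  = (h a)*            (h turns ′ into the De Morgan negation)
--     a′′     = e (h a)           (double negation is the "closure" e ∘ h).
-- The semi De Morgan axioms then follow by transporting the De Morgan laws
-- of 𝔻 along h and e, using that h is a lattice homomorphism and e preserves
-- meets and the bounds.  For the kernel K = {a′′}, the map x ↦ h x is an
-- isomorphism onto 𝔻 with inverse α ↦ (e α)′′: every kernel operation is
-- some lattice expression followed by ′′, which h cannot see (h (a′′) = h a).
-- In the Boolean case, a′ ∧ a′′ = e (h a * ∩ h a) = e 0 = ⊥.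

open import Defs
open import Data.Product using (_×_; _,_; proj₁)
open import Relation.Binary.PropositionalEquality
  using (_≡_; sym; trans; cong; cong₂; module ≡-Reasoning)
open import Algebra.Lattice.Structures using (IsDistributiveLattice)

module HSMAFacts {L D : Set} (H : HSMA L D) where
  open HSMA H
  open ≡-Reasoning

  _′ : L → L
  _′ = prime₊ H

  -- h preserves the bounds: they are images of the bounds of 𝔻 under e.
  h-⊥ : h L.⊥ ≡ D.0d
  h-⊥ = trans (cong h (sym e-0)) (h∘e D.0d)

  h-⊤ : h L.⊤ ≡ D.1d
  h-⊤ = trans (cong h (sym e-1)) (h∘e D.1d)

  h-′ : ∀ a → h (a ′) ≡ (h a D.*)
  h-′ a = h∘e (h a D.*)

  ′′≡e∘h : ∀ a → ((a ′) ′) ≡ e (h a)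
  ′′≡e∘h a = cong e (begin
    (h (a ′) D.*)     ≡⟨ cong D._* (h-′ a) ⟩
    ((h a D.*) D.*)   ≡⟨ D.** (h a) ⟩
    h a               ∎)

  h-′′ : ∀ a → h ((a ′) ′) ≡ h a
  h-′′ a = trans (cong h (′′≡e∘h a)) (h∘e (h a))

  ⊥′ : (L.⊥ ′) ≡ L.⊤
  ⊥′ = begin
    e (h L.⊥ D.*)  ≡⟨ cong (λ δ → e (δ D.*)) h-⊥ ⟩
    e (D.0d D.*)   ≡⟨ cong e D.0*≡1 ⟩
    e D.1d         ≡⟨ e-1 ⟩
    L.⊤            ∎

  ⊤′ : (L.⊤ ′) ≡ L.⊥
  ⊤′ = begin
    e (h L.⊤ D.*)  ≡⟨ cong (λ δ → e (δ D.*)) h-⊤ ⟩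
    e (D.1d D.*)   ≡⟨ cong e D.1*≡0 ⟩
    e D.0d         ≡⟨ e-0 ⟩
    L.⊥            ∎

  ∨′ : ∀ a b → ((a L.∨ b) ′) ≡ ((a ′) L.∧ (b ′))
  ∨′ a b = begin
    e (h (a L.∨ b) D.*)             ≡⟨ cong (λ δ → e (δ D.*)) (h-∨ a b) ⟩
    e ((h a D.∪ h b) D.*)           ≡⟨ cong e (D.∪-* (h a) (h b)) ⟩
    e ((h a D.*) D.∩ (h b D.*))     ≡⟨ sym (e-∩ (h a D.*) (h b D.*)) ⟩
    (e (h a D.*) L.∧ e (h b D.*))   ∎

  ∧′′ : ∀ a b → (((a L.∧ b) ′) ′) ≡ (((a ′) ′) L.∧ ((b ′) ′))
  ∧′′ a b = begin
    (((a L.∧ b) ′) ′)            ≡⟨ ′′≡e∘h (a L.∧ b) ⟩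
    e (h (a L.∧ b))              ≡⟨ cong e (h-∧ a b) ⟩
    e (h a D.∩ h b)              ≡⟨ sym (e-∩ (h a) (h b)) ⟩
    (e (h a) L.∧ e (h b))        ≡⟨ sym (cong₂ L._∧_ (′′≡e∘h a) (′′≡e∘h b)) ⟩
    (((a ′) ′) L.∧ ((b ′) ′))    ∎

  ′′′ : ∀ a → (a ′) ≡ (((a ′) ′) ′)
  ′′′ a = sym (cong (λ δ → e (δ D.*)) (h-′′ a))

  isSMA : IsSMA 𝕃 _′
  isSMA = record { ⊥′ = ⊥′ ; ⊤′ = ⊤′ ; ∨′ = ∨′ ; ∧′′ = ∧′′ ; ′′′ = ′′′ }

  open Kernel 𝕃 _′

  kernel-closed : ∀ x → e (h (ek x)) ≡ ek x
  kernel-closed (x , a , x≡a′′) = begin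
    e (h x)           ≡⟨ cong (λ y → e (h y)) x≡a′′ ⟩
    e (h ((a ′) ′))   ≡⟨ cong e (h-′′ a) ⟩
    e (h a)           ≡⟨ sym (′′≡e∘h a) ⟩
    ((a ′) ′)         ≡⟨ sym x≡a′′ ⟩
    x                 ∎

  -- h restricted to the kernel is an isomorphism onto 𝔻, inverse α ↦ (e α)′′.
  -- Each kernel operation is hk applied to a lattice term, and h ∘ hk = h.
  kernelIso : KernelIso 𝕃 _′ 𝔻
  kernelIso = record
    { to       = λ x → h (ek x)
    ; from     = λ α → hk (e α)
    ; to-resp  = λ x y → cong h
    ; to∘from  = λ α → trans (h-′′ (e α)) (h∘e α)
    ; from∘to  = λ x → trans (′′≡e∘h (e (h (ek x))))
                             (trans (cong e (h∘e (h (ek x)))) (kernel-closed x))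
    ; to-∩     = λ x y → trans (h-′′ _) (h-∧ (ek x) (ek y))
    ; to-∪     = λ x y → trans (h-′′ _) (trans (h-′′ _) (h-∨ (ek x) (ek y)))
    ; to-*     = λ x → trans (h-′′ _) (h-′ (ek x))
    ; to-1     = trans (h-′′ L.⊤) h-⊤
    ; to-0     = trans (h-′′ L.⊥) h-⊥
    }

module HDPLFacts {L D : Set} (H : HDPL L D) where
  open HDPL H
  open HSMAFacts hsma
  open ≡-Reasoning
  open IsDistributiveLattice D.isDistributiveLattice using (∧-comm)

  ′-∧-′′ : ∀ a → ((a ′) L.∧ ((a ′) ′)) ≡ L.⊥
  ′-∧-′′ a = begin
    (e (h a D.*) L.∧ ((a ′) ′))  ≡⟨ cong (e (h a D.*) L.∧_) (′′≡e∘h a) ⟩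
    (e (h a D.*) L.∧ e (h a))    ≡⟨ e-∩ (h a D.*) (h a) ⟩
    e ((h a D.*) D.∩ h a)        ≡⟨ cong e (∧-comm (h a D.*) (h a)) ⟩
    e (h a D.∩ (h a D.*))        ≡⟨ cong e (D-compl (h a)) ⟩
    e D.0d                       ≡⟨ e-0 ⟩
    L.⊥                          ∎

  isDemiPL : IsDemiPL 𝕃 _′
  isDemiPL = record { isSMA = isSMA ; ′-∧-′′ = ′-∧-′′ }

proposition3p11 : (∀ {L D : Set} (H : HSMA L D) → IsSMA (HSMA.𝕃 H) (prime₊ H) × KernelIso (HSMA.𝕃 H) (prime₊ H) (HSMA.𝔻 H)) × (∀ {L D : Set} (H : HDPL L D) → IsDemiPL (HSMA.𝕃 (HDPL.hsma H)) (prime₊ (HDPL.hsma H)) × KernelIso (HSMA.𝕃 (HDPL.hsma H)) (prime₊ (HDPL.hsma H)) (HSMA.𝔻 (HDPL.hsma H)))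
proposition3p11 =
  (λ H → HSMAFacts.isSMA H , HSMAFacts.kernelIso H) ,
  (λ H → HDPLFacts.isDemiPL H , HSMAFacts.kernelIso (HDPL.hsma H))
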